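{- Let $K$ be a finite Eulerian poset with minimum $\hat 0$ and rank function $\rho$, and let $P\in\mathrm{Or}(K)$ be a special partial projection, i.e. an idempotent of the monoid $M_p^K$ which is a projection. Then the induced subposets $\mathrm{Im}(P)$ and $(K\setminus\mathrm{Im}(P))\cup\{\hat 0\}$ of $K$ are graded with rank function (the restriction of) $\rho$.
   Context: A finite poset $K$ is graded if it has a minimum $\hat 0$, maximum $\hat 1$ and rank function $\rho$ ($\rho(y)=\rho(x)+1$ whenever $y$ covers $x$, written $x\vartriangleleft y$); it is Eulerian if moreover $\mu_K(x,y)=(-1)^{\rho(y)-\rho(x)}$ for all $x\leqslant y$. $\mathrm{Or}(K)$ is the monoid under composition of order preserving regressive ($f(x)\leqslant x$) maps $K\to K$. A partial matching of $K$ is a map $M_p:K\to K$ with $M_p\circ M_p=\mathrm{id}_K$, $M_p(\hat 1)\vartriangleleft\hat 1$, and for every $x$ either $M_p(x)\vartriangleleft x$, $x\vartriangleleft M_p(x)$ or $M_p(x)=x$; it is a special partial matching if $x\vartriangleleft y$ and $x\ne M_p(y)$ imply $M_p(x)\leqslant M_p(y)$. For such $M_p$, $P^{M_p}(x)=x$ if $x\leqslant M_p(x)$ and $P^{M_p}(x)=M_p(x)$ if $M_p(x)\vartriangleleft x$. $M_p^K$ is the submonoid of $\mathrm{Or}(K)$ generated by $\mathrm{id}_K$ and all $P^{M_p}$, $M_p$ a special partial matching of $K$. For $f:K\to K$, $f_y:=\{x:f(x)=y\}$. An idempotent $P\in\mathrm{Or}(K)$ is a projection if for all $x,y\in\mathrm{Im}(P)$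 with $x\leqslant y$ the set $[x,y]\cap P_x$ is an interval of $K$. -}

module Defs where

open import Data.Nat using (ℕ; zero; suc; _∸_) renaming (_+_ to _+ℕ_)
open import Data.Integer using (ℤ; 0ℤ; 1ℤ; -1ℤ; _+_; -_; _^_)
open import Data.Fin using (Fin)
open import Data.Fin.Properties using (_≟_)
open import Data.List using (List; []; _∷_; map; foldr; allFin)
open import Data.Bool using (Bool; if_then_else_; _∧_; not)
open import Data.Product using (Σ; ∃; _×_; _,_; proj₁)
open import Data.Sum using (_⊎_)
open import Relation.Nullary using (¬_; does)
open import Relation.Binary using (Rel; IsPartialOrder; Decidable)
open import Relation.Binary.PropositionalEquality using (_≡_)
open import Function using (_⇔_)

record FinPoset : Set₁ where
  field
    n    : ℕ
    _≤_  : Rel (Fin n) _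
    isPartialOrder : IsPartialOrder _≡_ _≤_
    _≤?_ : Decidable _≤_

  Elt : Set
  Elt = Fin n

  _<_ : Elt → Elt → Set
  x < y = (x ≤ y) × ¬ (x ≡ y)

  _⋖_ : Elt → Elt → Set
  x ⋖ y = (x < y) × (∀ z → x ≤ z → z ≤ y → (z ≡ x) ⊎ (z ≡ y))

  Σᴷ : (Elt → ℤ) → ℤ
  Σᴷ f = foldr _+_ 0ℤ (map f (allFin n))

  -- Möbius function of K, computed by the standard recursion
  --   μ(x,x) = 1,  μ(x,y) = - Σ_{x ≤ z < y} μ(x,z)  (x < y),  μ(x,y) = 0 otherwise,
  -- with a fuel argument; fuel n (= |K|) is sufficient since every
  -- strict chain in K has at most n elements.
  mobiusF : ℕ → Elt → Elt → ℤ
  mobiusF zero    x y = 0ℤ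
  mobiusF (suc k) x y =
    if does (x ≟ y) then 1ℤ
    else if does (x ≤? y)
      then - Σᴷ (λ z → if does (x ≤? z) ∧ does (z ≤? y) ∧ not (does (z ≟ y))
                         then mobiusF k x z else 0ℤ)
      else 0ℤ

  μ : Elt → Elt → ℤ
  μ = mobiusF n

  CoverIn : (Elt → Set) → Elt → Elt → Set
  CoverIn S x y = (x < y) × (∀ z → S z → x ≤ z → z ≤ y → (z ≡ x) ⊎ (z ≡ y))

  GradedSub : (Elt → Set) → (Elt → ℕ) → Set
  GradedSub S ρ =
      (∃ λ m → S m × (∀ x → S x → m ≤ x))
    × (∃ λ M → S M × (∀ x → S x → x ≤ M))
    × (∀ x y → S x → S y → CoverIn S x y → ρ y ≡ suc (ρ x))

open FinPoset public

record Graded (K : FinPoset) : Set where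
  field
    𝟘   : Elt K
    𝟙   : Elt K
    𝟘-min : ∀ x → _≤_ K 𝟘 x
    𝟙-max : ∀ x → _≤_ K x 𝟙
    ρ   : Elt K → ℕ
    ρ-cover : ∀ x y → _⋖_ K x y → ρ y ≡ suc (ρ x)

open Graded public

Eulerian : (K : FinPoset) → Graded K → Set
Eulerian K G = ∀ x y → _≤_ K x y → μ K x y ≡ -1ℤ ^ (ρ G y ∸ ρ G x)

module _ (K : FinPoset) (G : Graded K) where
  private
    E = Elt K
    _≤'_ = _≤_ K
    _⋖'_ = _⋖_ K

  IsPartialMatching : (E → E) → Set
  IsPartialMatching M =
      (∀ x → M (M x) ≡ x)
    × (M (𝟙 G) ⋖' 𝟙 G)
    × (∀ x → (M x ⋖' x) ⊎ (x ⋖' M x) ⊎ (M x ≡ x))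

  IsSpecialPartialMatching : (E → E) → Set
  IsSpecialPartialMatching M =
      IsPartialMatching M
    × (∀ x y → x ⋖' y → ¬ (x ≡ M y) → M x ≤' M y)

  SPM : Set
  SPM = Σ (E → E) IsSpecialPartialMatching

Pᴹ : (K : FinPoset) → (Elt K → Elt K) → Elt K → Elt K
Pᴹ K M x = if does (_≤?_ K x (M x)) then x else M x

evalWord : (K : FinPoset) (G : Graded K) → List (SPM K G) → Elt K → Elt K
evalWord K G []       x = x
evalWord K G (M ∷ ws) x = Pᴹ K (proj₁ M) (evalWord K G ws x)

-- f ∈ M_p^K : the submonoid of Or(K) generated by id_K and the P^{M_p}
InMpK : (K : FinPoset) (G : Graded K) → (Elt K → Elt K) → Set
InMpK K G f = ∃ λ (w : List (SPM K G)) → ∀ x → f x ≡ evalWord K G w x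

Idempotent : (K : FinPoset) → (Elt K → Elt K) → Set
Idempotent K f = ∀ x → f (f x) ≡ f x

InImage : (K : FinPoset) → (Elt K → Elt K) → Elt K → Set
InImage K f y = ∃ λ x → f x ≡ y

IsProjection : (K : FinPoset) → (Elt K → Elt K) → Set
IsProjection K P =
    Idempotent K P
  × (∀ x y → InImage K P x → InImage K P y → _≤_ K x y →
       ∃ λ a → ∃ λ b → ∀ z →
         ((_≤_ K x z × _≤_ K z y × P z ≡ x) ⇔ (_≤_ K a z × _≤_ K z b)))

ComplPlusZero : (K : FinPoset) (G : Graded K) → (Elt K → Elt K) → Elt K → Set
ComplPlusZero K G P x = (¬ InImage K P x) ⊎ (x ≡ 𝟘 G)

-- Every P in M_p^K is regressive and order preserving: each generator P^M is,
-- the special condition giving monotonicity along covers, and monotonicity along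
-- covers is monotonicity. An Eulerian poset is thin: if d ⋖ c ⋖ y then some
-- c′ ≠ c lies strictly between d and y, since otherwise μ(d,y) = -(1 - 1) = 0
-- instead of (-1)². Consequently a non-empty open interval (x,y) has two coatoms
-- above x and so no upper bound below y. If y covers x in Im(P), the projection
-- property makes [x,y] ∩ P_x an interval [a,b] with b < y bounding (x,y); if y
-- covers x in the complement, every element of (x,y) is fixed by P and P(y) < y
-- bounds it. In both cases x ⋖ y in K, so ρ(y) = ρ(x) + 1.

module Submission where

open import Data.Bool using (Bool; if_then_else_; _∧_; not)
open import Data.Empty using (⊥; ⊥-elim)
open import Data.Fin using (Fin; zero; suc)
open import Data.Fin.Induction using (po-wellFounded; po-noetherian)
open import Data.Fin.Properties using (_≟_; any?; suc-injective; injective⇒≤)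
open import Data.Integer using (ℤ; 0ℤ; 1ℤ; -1ℤ; -_; _+_; _^_)
open import Data.Integer.Properties using (+-identityˡ; +-identityʳ; +-comm)
open import Data.List using (List; []; _∷_; foldr; tabulate)
open import Data.List.Properties using (map-tabulate)
open import Data.Nat using (suc; _∸_)
import Data.Nat as ℕ
open import Data.Nat.Properties using (m+n∸n≡m; m≤n⇒∃[o]m+o≡n)
open import Data.Product using (_×_; ∃; _,_; proj₁; proj₂)
open import Data.Sum using (_⊎_; inj₁; inj₂)
open import Function using (_∘_; id; flip; Equivalence)
open import Induction.WellFounded using (Acc; acc)
open import Relation.Binary using (IsPartialOrder)
open import Relation.Binary.PropositionalEquality using (_≡_; _≢_; refl; sym; trans; cong; cong₂; subst; module ≡-Reasoning)
open import Relation.Nullary using (¬_; Dec; yes; no; does)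
open import Relation.Nullary.Decidable using (_×-dec_; ¬?)

open import Defs hiding (_≤_; _<_; _⋖_; _≤?_; isPartialOrder)

∑ : ∀ {m} → (Fin m → ℤ) → ℤ
∑ f = foldr _+_ 0ℤ (tabulate f)

∑-zero : ∀ {m} (f : Fin m → ℤ) → (∀ z → f z ≡ 0ℤ) → ∑ f ≡ 0ℤ
∑-zero {ℕ.zero}  f vanish = refl
∑-zero {ℕ.suc m} f vanish
  rewrite vanish zero | ∑-zero (f ∘ suc) (vanish ∘ suc) = refl

∑-single : ∀ {m} (f : Fin m → ℤ) (a : Fin m) →
           (∀ z → z ≢ a → f z ≡ 0ℤ) → ∑ f ≡ f a
∑-single f zero vanish
  rewrite ∑-zero (f ∘ suc) (λ z → vanish (suc z) λ ()) = +-identityʳ (f zero)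
∑-single f (suc a) vanish
  rewrite vanish zero (λ ())
        | ∑-single (f ∘ suc) a (λ z z≢a → vanish (suc z) (z≢a ∘ suc-injective))
  = +-identityˡ (f (suc a))

∑-pair : ∀ {m} (f : Fin m → ℤ) (a b : Fin m) → a ≢ b →
         (∀ z → z ≢ a → z ≢ b → f z ≡ 0ℤ) → ∑ f ≡ f a + f b
∑-pair f zero zero a≢b vanish = ⊥-elim (a≢b refl)
∑-pair f zero (suc b) a≢b vanish
  rewrite ∑-single (f ∘ suc) b (λ z z≢b → vanish (suc z) (λ ()) (z≢b ∘ suc-injective))
  = refl
∑-pair f (suc a) zero a≢b vanish
  rewrite ∑-single (f ∘ suc) a (λ z z≢a → vanish (suc z) (z≢a ∘ suc-injective) (λ ()))
  = +-comm (f zero) (f (suc a))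
∑-pair f (suc a) (suc b) a≢b vanish
  rewrite vanish zero (λ ()) (λ ())
        | ∑-pair (f ∘ suc) a b (a≢b ∘ cong suc)
            (λ z z≢a z≢b → vanish (suc z) (z≢a ∘ suc-injective) (z≢b ∘ suc-injective))
  = +-identityˡ _

three-distinct⇒3≤ : ∀ {m} {a b c : Fin m} → a ≢ b → a ≢ c → b ≢ c → 3 ℕ.≤ m
three-distinct⇒3≤ {a = a} {b} {c} a≢b a≢c b≢c = injective⇒≤ injective
  where
  pick : Fin 3 → Fin _
  pick zero             = a
  pick (suc zero)       = b
  pick (suc (suc zero)) = c

  injective : ∀ {i j} → pick i ≡ pick j → i ≡ j
  injective {zero}             {zero}             _ = refl
  injective {zero}             {suc zero}         e = ⊥-elim (a≢b e)
  injective {zero}             {suc (suc zero)}   e = ⊥-elim (a≢c e)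
  injective {suc zero}         {zero}             e = ⊥-elim (a≢b (sym e))
  injective {suc zero}         {suc zero}         _ = refl
  injective {suc zero}         {suc (suc zero)}   e = ⊥-elim (b≢c e)
  injective {suc (suc zero)}   {zero}             e = ⊥-elim (a≢c (sym e))
  injective {suc (suc zero)}   {suc zero}         e = ⊥-elim (b≢c (sym e))
  injective {suc (suc zero)}   {suc (suc zero)}   _ = refl

module _ (K : FinPoset) where
  open FinPoset K using (_≤_; _<_; _⋖_; _≤?_; isPartialOrder)
  open IsPartialOrder isPartialOrder using (antisym)
    renaming (refl to ≤-refl; reflexive to ≤-reflexive; trans to ≤-trans)

  private
    variable
      x y z b c d : Elt K

  <-dec : ∀ x y → Dec (x < y)
  <-dec x y = (x ≤? y) ×-dec ¬? (x ≟ y)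

  <-≤-trans : x < y → y ≤ z → x < z
  <-≤-trans (x≤y , x≢y) y≤z = ≤-trans x≤y y≤z , λ { refl → x≢y (antisym x≤y y≤z) }

  ≤-<-trans : x ≤ y → y < z → x < z
  ≤-<-trans x≤y (y≤z , y≢z) = ≤-trans x≤y y≤z , λ { refl → y≢z (antisym y≤z x≤y) }

  ⋖-below-top : x ⋖ y → x ≤ z → z < y → z ≡ x
  ⋖-below-top (_ , ends) x≤z (z≤y , z≢y) with ends _ x≤z z≤y
  ... | inj₁ z≡x = z≡x
  ... | inj₂ z≡y = ⊥-elim (z≢y z≡y)

  ⋖-above-bottom : x ⋖ y → x < z → z ≤ y → z ≡ y
  ⋖-above-bottom (_ , ends) (x≤z , x≢z) z≤y with ends _ x≤z z≤y
  ... | inj₁ z≡x = ⊥-elim (x≢z (sym z≡x))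
  ... | inj₂ z≡y = z≡y

  empty-open-interval⇒⋖ : x < y → (∀ z → x < z → z < y → ⊥) → x ⋖ y
  empty-open-interval⇒⋖ {x} {y} x<y empty = x<y , ends
    where
    ends : ∀ z → x ≤ z → z ≤ y → z ≡ x ⊎ z ≡ y
    ends z x≤z z≤y with z ≟ x | z ≟ y
    ... | yes z≡x | _       = inj₁ z≡x
    ... | no _    | yes z≡y = inj₂ z≡y
    ... | no z≢x  | no z≢y  = ⊥-elim (empty z (x≤z , z≢x ∘ sym) (z≤y , z≢y))

  ⋖-or-between : x < y → x ⋖ y ⊎ ∃ λ z → x < z × z < y
  ⋖-or-between {x} {y} x<y with any? (λ z → <-dec x z ×-dec <-dec z y)
  ... | yes between = inj₂ between
  ... | no none     = inj₁ (empty-open-interval⇒⋖ x<y λ z x<z z<y → none (z , x<z , z<y))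

  coatom-above : x < y → ∃ λ c → x ≤ c × c ⋖ y
  coatom-above {x} {y} x<y = climb ≤-refl x<y (po-noetherian isPartialOrder x)
    where
    climb : x ≤ c → c < y → Acc (flip _<_) c → ∃ λ c′ → x ≤ c′ × c′ ⋖ y
    climb {c} x≤c c<y (acc higher) with ⋖-or-between c<y
    ... | inj₁ c⋖y             = c , x≤c , c⋖y
    ... | inj₂ (w , c<w , w<y) = climb (≤-trans x≤c (proj₁ c<w)) w<y (higher c<w)

  ⋖-preserving⇒monotone : (f : Elt K → Elt K) → (∀ {x y} → x ⋖ y → f x ≤ f y) →
                          x ≤ y → f x ≤ f y
  ⋖-preserving⇒monotone {x} f preserves x≤y = descend x≤y (po-wellFounded isPartialOrder _)
    where
    descend : x ≤ y → Acc _<_ y → f x ≤ f y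
    descend {y} x≤y (acc lower) with x ≟ y
    ... | yes refl = ≤-refl
    ... | no x≢y with coatom-above (x≤y , x≢y)
    ...   | c , x≤c , c⋖y = ≤-trans (descend x≤c (lower (proj₁ c⋖y))) (preserves c⋖y)

  inHalfOpen : Elt K → Elt K → Elt K → Bool
  inHalfOpen x y z = does (x ≤? z) ∧ does (z ≤? y) ∧ not (does (z ≟ y))

  inHalfOpen-yes : ∀ {A : Set} {p q : A} → x ≤ z → z < y →
                   (if inHalfOpen x y z then p else q) ≡ p
  inHalfOpen-yes {x} {z} {y} x≤z (z≤y , z≢y) with x ≤? z | z ≤? y | z ≟ y
  ... | yes _  | yes _  | no _    = refl
  ... | no x≰z | _      | _       = ⊥-elim (x≰z x≤z)
  ... | yes _  | no z≰y | _       = ⊥-elim (z≰y z≤y)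
  ... | yes _  | yes _  | yes z≡y = ⊥-elim (z≢y z≡y)

  inHalfOpen-no : ∀ {A : Set} {p q : A} → ¬ (x ≤ z × z < y) →
                  (if inHalfOpen x y z then p else q) ≡ q
  inHalfOpen-no {x} {z} {y} outside with x ≤? z | z ≤? y | z ≟ y
  ... | yes x≤z | yes z≤y | no z≢y = ⊥-elim (outside (x≤z , z≤y , z≢y))
  ... | no _    | _       | _      = refl
  ... | yes _   | no _    | _      = refl
  ... | yes _   | yes _   | yes _  = refl

  Σᴷ-tabulate : (f : Elt K → ℤ) → Σᴷ K f ≡ ∑ f
  Σᴷ-tabulate f = cong (foldr _+_ 0ℤ) (map-tabulate id f)

  mobiusF-refl : ∀ k x → mobiusF K (suc k) x x ≡ 1ℤ
  mobiusF-refl k x with x ≟ x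
  ... | yes _   = refl
  ... | no x≢x = ⊥-elim (x≢x refl)

  mobiusF-< : ∀ k → x < y →
              mobiusF K (suc k) x y ≡ - ∑ (λ z → if inHalfOpen x y z then mobiusF K k x z else 0ℤ)
  mobiusF-< {x} {y} k (x≤y , x≢y) with x ≟ y | x ≤? y
  ... | yes x≡y | _       = ⊥-elim (x≢y x≡y)
  ... | no _    | no x≰y  = ⊥-elim (x≰y x≤y)
  ... | no _    | yes _   = cong -_ (Σᴷ-tabulate _)

  mobiusF-⋖ : ∀ k → d ⋖ c → mobiusF K (2 ℕ.+ k) d c ≡ -1ℤ
  mobiusF-⋖ {d} {c} k d⋖c@(d<c , _) = begin
    mobiusF K (2 ℕ.+ k) d c  ≡⟨ mobiusF-< (suc k) d<c ⟩
    - ∑ summand              ≡⟨ cong -_ (∑-single summand d only-d) ⟩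
    - summand d              ≡⟨ cong -_ (inHalfOpen-yes ≤-refl d<c) ⟩
    - mobiusF K (suc k) d d  ≡⟨ cong -_ (mobiusF-refl k d) ⟩
    -1ℤ                      ∎
    where
    open ≡-Reasoning
    summand : Elt K → ℤ
    summand z = if inHalfOpen d c z then mobiusF K (suc k) d z else 0ℤ
    only-d : ∀ z → z ≢ d → summand z ≡ 0ℤ
    only-d z z≢d = inHalfOpen-no λ (d≤z , z<c) → z≢d (⋖-below-top d⋖c d≤z z<c)

  mobiusF-no-diamond : ∀ k → d ⋖ c → c ⋖ y → (∀ z → d < z → z < y → z ≡ c) →
                       mobiusF K (3 ℕ.+ k) d y ≡ 0ℤ
  mobiusF-no-diamond {d} {c} {y} k d⋖c@(d<c , _) (c<y , _) only-c = begin
    mobiusF K (3 ℕ.+ k) d y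
      ≡⟨ mobiusF-< (2 ℕ.+ k) d<y ⟩
    - ∑ summand
      ≡⟨ cong -_ (∑-pair summand d c (proj₂ d<c) only-d-c) ⟩
    - (summand d + summand c)
      ≡⟨ cong -_ (cong₂ _+_ (inHalfOpen-yes ≤-refl d<y) (inHalfOpen-yes (proj₁ d<c) c<y)) ⟩
    - (mobiusF K (2 ℕ.+ k) d d + mobiusF K (2 ℕ.+ k) d c)
      ≡⟨ cong -_ (cong₂ _+_ (mobiusF-refl (suc k) d) (mobiusF-⋖ k d⋖c)) ⟩
    - (1ℤ + -1ℤ)
      ≡⟨⟩
    0ℤ ∎
    where
    open ≡-Reasoning
    d<y : d < y
    d<y = <-≤-trans d<c (proj₁ c<y)
    summand : Elt K → ℤ
    summand z = if inHalfOpen d y z then mobiusF K (2 ℕ.+ k) d z else 0ℤ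
    only-d-c : ∀ z → z ≢ d → z ≢ c → summand z ≡ 0ℤ
    only-d-c z z≢d z≢c = inHalfOpen-no λ (d≤z , z<y) → z≢c (only-c z (d≤z , z≢d ∘ sym) z<y)

  module _ (G : Graded K) where

    ≮𝟘 : ¬ x < 𝟘 G
    ≮𝟘 (x≤𝟘 , x≢𝟘) = x≢𝟘 (antisym x≤𝟘 (𝟘-min G _))

    rank-gap-⋖⋖ : d ⋖ c → c ⋖ y → ρ G y ∸ ρ G d ≡ 2
    rank-gap-⋖⋖ {d} {c} {y} d⋖c c⋖y = begin
      ρ G y ∸ ρ G d             ≡⟨ cong (_∸ ρ G d) (ρ-cover G c y c⋖y) ⟩
      suc (ρ G c) ∸ ρ G d       ≡⟨ cong (λ r → suc r ∸ ρ G d) (ρ-cover G d c d⋖c) ⟩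
      2 ℕ.+ ρ G d ∸ ρ G d       ≡⟨ m+n∸n≡m 2 (ρ G d) ⟩
      2                         ∎
      where open ≡-Reasoning

    eulerian⇒diamond : Eulerian K G → d ⋖ c → c ⋖ y → ∃ λ c′ → d < c′ × c′ < y × c′ ≢ c
    eulerian⇒diamond {d} {c} {y} eulerian d⋖c@(d<c , _) c⋖y@(c<y , _)
      with any? (λ z → <-dec d z ×-dec <-dec z y ×-dec ¬? (z ≟ c))
    ... | yes diamond = diamond
    ... | no none = ⊥-elim (0≢1 (trans (sym μ-vanishes) μ-is-1))
      where
      d<y : d < y
      d<y = <-≤-trans d<c (proj₁ c<y)

      0≢1 : 0ℤ ≢ 1ℤ
      0≢1 ()

      only-c : ∀ z → d < z → z < y → z ≡ c
      only-c z d<z z<y with z ≟ c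
      ... | yes z≡c = z≡c
      ... | no z≢c  = ⊥-elim (none (z , d<z , z<y , z≢c))

      μ-is-1 : μ K d y ≡ 1ℤ
      μ-is-1 = trans (eulerian d y (proj₁ d<y)) (cong (-1ℤ ^_) (rank-gap-⋖⋖ d⋖c c⋖y))

      μ-vanishes : μ K d y ≡ 0ℤ
      μ-vanishes with m≤n⇒∃[o]m+o≡n (three-distinct⇒3≤ (proj₂ d<c) (proj₂ d<y) (proj₂ c<y))
      ... | k , 3+k≡n = subst (λ fuel → mobiusF K fuel d y ≡ 0ℤ) 3+k≡n
                          (mobiusF-no-diamond k d⋖c c⋖y only-c)

    bounded-open-interval⇒⋖ : Eulerian K G → x < y → b < y →
                              (∀ u → x < u → u < y → u ≤ b) → x ⋖ y
    bounded-open-interval⇒⋖ {x} {y} {b} eulerian x<y b<y bound =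
      empty-open-interval⇒⋖ x<y unbounded
      where
      -- Two coatoms c ≠ c′ of y above x would both lie below b, forcing b = c and c′ ≤ c.
      unbounded : ∀ z → x < z → z < y → ⊥
      unbounded z x<z z<y with coatom-above z<y
      ... | c , z≤c , c⋖y@(c<y , _) with coatom-above (<-≤-trans x<z z≤c)
      ...   | d , x≤d , d⋖c with eulerian⇒diamond eulerian d⋖c c⋖y
      ...     | c′ , d<c′ , c′<y , c′≢c = c′≢c (⋖-above-bottom d⋖c d<c′ c′≤c)
        where
        b≡c : b ≡ c
        b≡c = ⋖-below-top c⋖y (bound c (<-≤-trans x<z z≤c) c<y) b<y
        c′≤c : c′ ≤ c
        c′≤c = subst (c′ ≤_) b≡c (bound c′ (≤-<-trans x≤d d<c′) c′<y)

    Pᴹ-regressive : ∀ {m} → IsPartialMatching K G m → ∀ x → Pᴹ K m x ≤ x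
    Pᴹ-regressive {m} (_ , _ , adjacent) x with x ≤? m x
    ... | yes _ = ≤-refl
    ... | no x≰mx with adjacent x
    ...   | inj₁ (mx<x , _)         = proj₁ mx<x
    ...   | inj₂ (inj₁ (x<mx , _)) = ⊥-elim (x≰mx (proj₁ x<mx))
    ...   | inj₂ (inj₂ mx≡x)       = ⊥-elim (x≰mx (≤-reflexive (sym mx≡x)))

    Pᴹ-moves-𝟙 : ∀ {m} → IsPartialMatching K G m → Pᴹ K m (𝟙 G) ≢ 𝟙 G
    Pᴹ-moves-𝟙 {m} (_ , ((m𝟙≤𝟙 , m𝟙≢𝟙) , _) , _) with 𝟙 G ≤? m (𝟙 G)
    ... | yes 𝟙≤m𝟙 = λ _ → m𝟙≢𝟙 (antisym m𝟙≤𝟙 𝟙≤m𝟙)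
    ... | no _     = m𝟙≢𝟙

    Pᴹ-preserves-⋖ : ∀ {m} → IsSpecialPartialMatching K G m → x ⋖ y → Pᴹ K m x ≤ Pᴹ K m y
    Pᴹ-preserves-⋖ {x} {y} {m} (matching , special) x⋖y@((x≤y , _) , _) with y ≤? m y
    ... | yes _ = ≤-trans (Pᴹ-regressive matching x) x≤y
    ... | no _ with x ≟ m y
    ...   | yes refl = Pᴹ-regressive matching x
    ...   | no x≢my with x ≤? m x
    ...     | yes x≤mx = ≤-trans x≤mx (special x y x⋖y x≢my)
    ...     | no _     = special x y x⋖y x≢my

    evalWord-regressive : ∀ w x → evalWord K G w x ≤ x
    evalWord-regressive []            x = ≤-refl
    evalWord-regressive ((m , spm) ∷ w) x =
      ≤-trans (Pᴹ-regressive (proj₁ spm) _) (evalWord-regressive w x)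

    evalWord-monotone : ∀ w → x ≤ y → evalWord K G w x ≤ evalWord K G w y
    evalWord-monotone []              x≤y = x≤y
    evalWord-monotone ((m , spm) ∷ w) x≤y =
      ⋖-preserving⇒monotone (Pᴹ K m) (Pᴹ-preserves-⋖ spm) (evalWord-monotone w x≤y)

    evalWord-fixing-𝟙⇒[] : ∀ w → evalWord K G w (𝟙 G) ≡ 𝟙 G → w ≡ []
    evalWord-fixing-𝟙⇒[] []              _     = refl
    evalWord-fixing-𝟙⇒[] ((m , spm) ∷ w) fixed =
      ⊥-elim (Pᴹ-moves-𝟙 (proj₁ spm) (subst (λ v → Pᴹ K m v ≡ 𝟙 G) w-fixes-𝟙 fixed))
      where
      w-fixes-𝟙 : evalWord K G w (𝟙 G) ≡ 𝟙 G
      w-fixes-𝟙 = antisym (evalWord-regressive w _)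
                    (subst (_≤ evalWord K G w (𝟙 G)) fixed (Pᴹ-regressive (proj₁ spm) _))

    module _ {f : Elt K → Elt K} (f∈MpK : InMpK K G f) where
      private
        w : List (SPM K G)
        w = proj₁ f∈MpK
        f≗w : ∀ x → f x ≡ evalWord K G w x
        f≗w = proj₂ f∈MpK

      InMpK⇒regressive : ∀ x → f x ≤ x
      InMpK⇒regressive x = subst (_≤ x) (sym (f≗w x)) (evalWord-regressive w x)

      InMpK⇒monotone : x ≤ y → f x ≤ f y
      InMpK⇒monotone {x} {y} x≤y
        rewrite f≗w x | f≗w y = evalWord-monotone w x≤y

      InMpK-fixing-𝟙⇒id : f (𝟙 G) ≡ 𝟙 G → ∀ x → f x ≡ x
      InMpK-fixing-𝟙⇒id f𝟙≡𝟙 x with evalWord-fixing-𝟙⇒[] w (trans (sym (f≗w (𝟙 G))) f𝟙≡𝟙)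
      ... | refl = f≗w x

    module _ (eulerian : Eulerian K G) {P : Elt K → Elt K}
             (P∈MpK : InMpK K G P) (idempotent : Idempotent K P) where

      image⇒fixed : InImage K P x → P x ≡ x
      image⇒fixed (v , refl) = idempotent v

      image-graded : IsProjection K P → GradedSub K (InImage K P) (ρ G)
      image-graded (_ , interval) =
          (𝟘 G , (𝟘 G , antisym (InMpK⇒regressive P∈MpK _) (𝟘-min G _)) , λ x _ → 𝟘-min G x)
        , (P (𝟙 G) , (𝟙 G , refl) ,
           λ x x∈Im → subst (_≤ P (𝟙 G)) (image⇒fixed x∈Im) (InMpK⇒monotone P∈MpK (𝟙-max G x)))
        , λ x y x∈Im y∈Im (x<y , ends) → ρ-cover G x y (covers x y x∈Im y∈Im x<y ends)
        where
        covers : ∀ x y → InImage K P x → InImage K P y → x < y →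
                 (∀ z → InImage K P z → x ≤ z → z ≤ y → z ≡ x ⊎ z ≡ y) → x ⋖ y
        covers x y x∈Im y∈Im x<y@(x≤y , x≢y) ends with interval x y x∈Im y∈Im x≤y
        ... | a , b , fibre⇔[a,b] = bounded-open-interval⇒⋖ eulerian x<y b<y bound
          where
          open Equivalence
          Px≡x : P x ≡ x
          Px≡x = image⇒fixed x∈Im
          Py≡y : P y ≡ y
          Py≡y = image⇒fixed y∈Im

          below-y-to-x : ∀ u → x ≤ u → u < y → P u ≡ x
          below-y-to-x u x≤u (u≤y , u≢y)
            with ends (P u) (u , refl)
                   (subst (_≤ P u) Px≡x (InMpK⇒monotone P∈MpK x≤u))
                   (≤-trans (InMpK⇒regressive P∈MpK u) u≤y)
          ... | inj₁ Pu≡x = Pu≡x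
          ... | inj₂ Pu≡y =
            ⊥-elim (u≢y (antisym u≤y (subst (_≤ u) Pu≡y (InMpK⇒regressive P∈MpK u))))

          a≤x≤b : a ≤ x × x ≤ b
          a≤x≤b = to (fibre⇔[a,b] x) (≤-refl , x≤y , Px≡x)
          b-in-fibre : x ≤ b × b ≤ y × P b ≡ x
          b-in-fibre = from (fibre⇔[a,b] b) (≤-trans (proj₁ a≤x≤b) (proj₂ a≤x≤b) , ≤-refl)

          b<y : b < y
          b<y = proj₁ (proj₂ b-in-fibre) ,
                λ b≡y → x≢y (trans (sym (proj₂ (proj₂ b-in-fibre))) (trans (cong P b≡y) Py≡y))

          bound : ∀ u → x < u → u < y → u ≤ b
          bound u (x≤u , _) u<y =
            proj₂ (to (fibre⇔[a,b] u) (x≤u , proj₁ u<y , below-y-to-x u x≤u u<y))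

      complement-graded : GradedSub K (ComplPlusZero K G P) (ρ G)
      complement-graded =
          (𝟘 G , inj₂ refl , λ x _ → 𝟘-min G x)
        , maximum
        , λ x y x∈S y∈S (x<y , ends) → ρ-cover G x y (covers x<y y∈S ends)
        where
        S : Elt K → Set
        S = ComplPlusZero K G P

        maximum : ∃ λ M → S M × (∀ x → S x → x ≤ M)
        maximum with P (𝟙 G) ≟ 𝟙 G
        ... | no P𝟙≢𝟙 = 𝟙 G , inj₁ (P𝟙≢𝟙 ∘ image⇒fixed) , λ x _ → 𝟙-max G x
        ... | yes P𝟙≡𝟙 = 𝟘 G , inj₂ refl , only-𝟘
          where
          only-𝟘 : ∀ x → S x → x ≤ 𝟘 G
          only-𝟘 x (inj₁ x∉Im) = ⊥-elim (x∉Im (x , InMpK-fixing-𝟙⇒id P∈MpK P𝟙≡𝟙 x))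
          only-𝟘 x (inj₂ refl) = ≤-refl

        covers : x < y → S y → (∀ z → S z → x ≤ z → z ≤ y → z ≡ x ⊎ z ≡ y) → x ⋖ y
        covers {x} {y} x<y y∈S ends = bounded-open-interval⇒⋖ eulerian x<y Py<y bound
          where
          between⇒fixed : ∀ u → x < u → u < y → P u ≡ u
          between⇒fixed u (x≤u , x≢u) (u≤y , u≢y) with P u ≟ u
          ... | yes Pu≡u = Pu≡u
          ... | no Pu≢u with ends u (inj₁ (Pu≢u ∘ image⇒fixed)) x≤u u≤y
          ...   | inj₁ u≡x = ⊥-elim (x≢u (sym u≡x))
          ...   | inj₂ u≡y = ⊥-elim (u≢y u≡y)

          Py≢y : S y → P y ≢ y
          Py≢y (inj₁ y∉Im) Py≡y = y∉Im (y , Py≡y)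
          Py≢y (inj₂ refl) _    = ≮𝟘 x<y

          Py<y : P y < y
          Py<y = InMpK⇒regressive P∈MpK y , Py≢y y∈S

          bound : ∀ u → x < u → u < y → u ≤ P y
          bound u x<u u<y =
            subst (_≤ P y) (between⇒fixed u x<u u<y) (InMpK⇒monotone P∈MpK (proj₁ u<y))

theorem5p8 : (K : FinPoset) (G : Graded K) → Eulerian K G →
    (P : Elt K → Elt K) → InMpK K G P → Idempotent K P → IsProjection K P →
    GradedSub K (InImage K P) (ρ G) × GradedSub K (ComplPlusZero K G P) (ρ G)
theorem5p8 K G eulerian P P∈MpK idempotent projection =
    image-graded K G eulerian P∈MpK idempotent projection
  , complement-graded K G eulerian P∈MpK idempotent
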